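{- Let $x\in\mathbb{R}$. The sequences $a\in\mathcal{S}(\mathbb{R})$ fixed by the operator $\eta\circ I^{(x)}$ have ordinary generating function $$\sum_{n\ge0}a_nt^n=\frac{1}{1+\frac{x}{2}t}.$$
   Context: $\mathcal{S}(\mathbb{R})$ denotes the set of real sequences $a=(a_n)_{n\ge0}$ with $a_0=1$. For $x\in\mathbb{R}$, the interpolated invert operator $I^{(x)}$ maps $a$ with ordinary generating function $\mathbf{A}(t)=\sum_n a_nt^n$ to the sequence with ordinary generating function $\frac{\mathbf{A}(t)}{1-xt\mathbf{A}(t)}$. The revert operator $\eta$ is defined by $\eta(a)=b$ iff the power series $u(t)=\sum_{n\ge0}a_nt^{n+1}$ and $t(u)=\sum_{n\ge0}b_nu^{n+1}$ are compositional inverses of each other. Composition: $(\eta\circ I^{(x)})(a)=\eta(I^{(x)}(a))$. -}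

module Defs where

open import Level using (_⊔_)
open import Data.Nat using (ℕ; zero; suc; _∸_)
open import Data.Product using (_×_)
open import Algebra.Bundles using (CommutativeRing)

module PowerSeries {c ℓ} (R : CommutativeRing c ℓ) where
  open CommutativeRing R

  Series : Set c
  Series = ℕ → Carrier

  _≋_ : Series → Series → Set ℓ
  f ≋ g = ∀ n → f n ≈ g n

  Σ< : ℕ → (ℕ → Carrier) → Carrier
  Σ< zero    f = 0#
  Σ< (suc n) f = Σ< n f + f n

  pow : Carrier → ℕ → Carrier
  pow x zero    = 1#
  pow x (suc k) = x * pow x k

  one : Series
  one zero    = 1#
  one (suc n) = 0#

  X : Series
  X zero          = 0#
  X (suc zero)    = 1#
  X (suc (suc n)) = 0#

  _·_ : Series → Series → Series
  (f · g) n = Σ< (suc n) (λ i → f i * g (n ∸ i))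

  _^ˢ_ : Series → ℕ → Series
  f ^ˢ zero    = one
  f ^ˢ (suc k) = f · (f ^ˢ k)

  -- composition g(f(t)) (meaningful when f 0 = 0)
  _∘ˢ_ : Series → Series → Series
  (g ∘ˢ f) n = Σ< (suc n) (λ k → g k * (f ^ˢ k) n)

  shift : Series → Series
  shift a zero    = 0#
  shift a (suc n) = a n

  -- interpolated invert operator: OGF A/(1 - x t A) = Σ_k x^k t^k A^{k+1}
  invert : Carrier → Series → Series
  invert x a n = Σ< (suc n) (λ k → pow x k * (a ^ˢ suc k) (n ∸ k))

  -- revert operator, as a relation: η(a) = b iff u(t) = Σ a_n t^{n+1} and
  -- t(u) = Σ b_n u^{n+1} are compositional inverses of each other
  IsRevert : Series → Series → Set ℓ
  IsRevert a b = ((shift b ∘ˢ shift a) ≋ X) × ((shift a ∘ˢ shift b) ≋ X)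

  onePlus : Carrier → Series
  onePlus k zero          = 1#
  onePlus k (suc zero)    = k
  onePlus k (suc (suc n)) = 0#

{-# OPTIONS --safe #-}
module Submission where

-- Put c = x/2 and b = 1/(1 + ct). Inverting b gives 1/(1 - ct), and t/(1 - ct), t/(1 + ct)
-- are compositional inverses, so b is a fixed point of η ∘ I^(x). Conversely, for any fixed
-- point a, with u = t I^(x)(a), the coefficient of t^(n+2) in Σ a_k u^(k+1) = t is
-- 2 a_(n+1) plus an expression in a_0, …, a_n only; as 2 is invertible, a fixed point is
-- determined by a_0 = 1, hence equals b. Finally b is the unique series whose product with
-- 1 + ct is 1.

open import Defs
open import Data.Nat using (ℕ; zero; suc; _∸_; _<_; s≤s)
open import Data.Nat.Properties
  using (m<n⇒m<1+n; n<1+n; m∸n≤m; n∸n≡0; +-∸-assoc; ≤-<-trans; ≤-pred; m≤n⇒m<n∨m≡n)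
open import Data.Product using (_,_; proj₁)
open import Data.Sum using (inj₁; inj₂)
open import Function.Bundles using (_⇔_; mk⇔; Equivalence)
open import Algebra.Bundles using (CommutativeRing)
import Algebra.Properties.Ring as RingProperties
import Algebra.Properties.CommutativeSemigroup as CommutativeSemigroupProperties
import Relation.Binary.PropositionalEquality as P

module SeriesLemmas {c ℓ} (R : CommutativeRing c ℓ) where
  open CommutativeRing R
  open PowerSeries R
  open RingProperties ring using (+-cancelʳ; +-inverseˡ-unique; -‿distribʳ-*)
  open CommutativeSemigroupProperties +-commutativeSemigroup using (interchange)
  open import Relation.Binary.Reasoning.Setoid setoid
  open import Algebra.Solver.Ring.NaturalCoefficients.Default commutativeSemiring

  Σ<-cong : ∀ n {f g : ℕ → Carrier} → (∀ i → i < n → f i ≈ g i) → Σ< n f ≈ Σ< n g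
  Σ<-cong zero    f≈g = refl
  Σ<-cong (suc n) f≈g = +-cong (Σ<-cong n (λ i i<n → f≈g i (m<n⇒m<1+n i<n))) (f≈g n (n<1+n n))

  Σ<-zero : ∀ n {f} → (∀ i → i < n → f i ≈ 0#) → Σ< n f ≈ 0#
  Σ<-zero zero    f≈0 = refl
  Σ<-zero (suc n) f≈0 =
    trans (+-cong (Σ<-zero n (λ i i<n → f≈0 i (m<n⇒m<1+n i<n))) (f≈0 n (n<1+n n))) (+-identityʳ 0#)

  Σ<-+ : ∀ n (f g : ℕ → Carrier) → Σ< n (λ i → f i + g i) ≈ Σ< n f + Σ< n g
  Σ<-+ zero    f g = sym (+-identityʳ 0#)
  Σ<-+ (suc n) f g = trans (+-congʳ (Σ<-+ n f g)) (interchange _ _ _ _)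

  *-distribˡ-Σ< : ∀ n k (f : ℕ → Carrier) → k * Σ< n f ≈ Σ< n (λ i → k * f i)
  *-distribˡ-Σ< zero    k f = zeroʳ k
  *-distribˡ-Σ< (suc n) k f = trans (distribˡ k _ _) (+-congʳ (*-distribˡ-Σ< n k f))

  Σ<-first : ∀ n (f : ℕ → Carrier) → Σ< (suc n) f ≈ f 0 + Σ< n (λ i → f (suc i))
  Σ<-first zero    f = trans (+-identityˡ _) (sym (+-identityʳ _))
  Σ<-first (suc n) f = trans (+-congʳ (Σ<-first n f)) (+-assoc _ _ _)

  Σ<-telescope : ∀ n (f g : ℕ → Carrier) → (∀ j → j < n → g j + f (suc j) ≈ 0#) →
                 Σ< (suc n) (λ j → f j + g j) ≈ f 0 + g n
  Σ<-telescope zero    f g _      = +-identityˡ _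
  Σ<-telescope (suc n) f g cancel = begin
    Σ< (suc n) (λ j → f j + g j) + (f (suc n) + g (suc n))
      ≈⟨ +-congʳ (Σ<-telescope n f g (λ j j<n → cancel j (m<n⇒m<1+n j<n))) ⟩
    (f 0 + g n) + (f (suc n) + g (suc n))
      ≈⟨ solve 4 (λ a b p q → (a :+ b) :+ (p :+ q) := (a :+ (b :+ p)) :+ q) refl
               (f 0) (g n) (f (suc n)) (g (suc n)) ⟩
    (f 0 + (g n + f (suc n))) + g (suc n)
      ≈⟨ +-congʳ (trans (+-congˡ (cancel n (n<1+n n))) (+-identityʳ _)) ⟩
    f 0 + g (suc n) ∎

  pow-cong : ∀ {d e} → d ≈ e → ∀ k → pow d k ≈ pow e k
  pow-cong d≈e zero    = refl
  pow-cong d≈e (suc k) = *-cong d≈e (pow-cong d≈e k)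

  pow-one : ∀ k → pow 1# k ≈ 1#
  pow-one zero    = refl
  pow-one (suc k) = trans (*-identityˡ _) (pow-one k)

  ≋-sym : ∀ {f g} → f ≋ g → g ≋ f
  ≋-sym f≋g n = sym (f≋g n)

  ≋-trans : ∀ {f g h} → f ≋ g → g ≋ h → f ≋ h
  ≋-trans f≋g g≋h n = trans (f≋g n) (g≋h n)

  coeff-n∸n : ∀ (f : Series) n → f (n ∸ n) ≈ f 0
  coeff-n∸n f n = reflexive (P.cong f (n∸n≡0 n))

  X-suc : ∀ n → X (suc n) P.≡ one n
  X-suc zero    = P.refl
  X-suc (suc n) = P.refl

  one-∸ : ∀ {n i} → i < n → one (n ∸ i) P.≡ 0#
  one-∸ {suc n} {zero}  _         = P.refl
  one-∸ {suc n} {suc i} (s≤s i<n) = one-∸ i<n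

  onePlus-suc-∸ : ∀ k {n i} → i < n → onePlus k (suc n ∸ i) P.≡ 0#
  onePlus-suc-∸ k {suc n} {zero}  _         = P.refl
  onePlus-suc-∸ k {suc n} {suc i} (s≤s i<n) = onePlus-suc-∸ k i<n

  onePlus-suc-∸-self : ∀ k n → onePlus k (suc n ∸ n) P.≡ k
  onePlus-suc-∸-self k zero    = P.refl
  onePlus-suc-∸-self k (suc n) = onePlus-suc-∸-self k n

  ·-coeff-zero : ∀ f g → (f · g) 0 ≈ f 0 * g 0
  ·-coeff-zero f g = +-identityˡ _

  ·-coeff-suc : ∀ f g n → (f · g) (suc n) ≈ f 0 * g (suc n) + ((λ i → f (suc i)) · g) n
  ·-coeff-suc f g n = Σ<-first (suc n) (λ i → f i * g (suc n ∸ i))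

  shift-·-suc : ∀ f g n → (shift f · g) (suc n) ≈ (f · g) n
  shift-·-suc f g n = trans (·-coeff-suc (shift f) g n) (trans (+-congʳ (zeroˡ _)) (+-identityˡ _))

  ·-constantFree : ∀ f g → f 0 ≈ 0# → g 0 ≈ 0# → ∀ m →
                   (f · g) (suc m) ≈ Σ< m (λ i → f (suc i) * g (m ∸ i))
  ·-constantFree f g f₀≈0 g₀≈0 m = begin
    (f · g) (suc m)
      ≈⟨ ·-coeff-suc f g m ⟩
    f 0 * g (suc m) + (Σ< m (λ i → f (suc i) * g (m ∸ i)) + f (suc m) * g (m ∸ m))
      ≈⟨ +-cong (trans (*-congʳ f₀≈0) (zeroˡ _))
                (+-congˡ (trans (*-congˡ (trans (coeff-n∸n g m) g₀≈0)) (zeroʳ _))) ⟩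
    0# + (Σ< m (λ i → f (suc i) * g (m ∸ i)) + 0#)
      ≈⟨ trans (+-identityˡ _) (+-identityʳ _) ⟩
    Σ< m (λ i → f (suc i) * g (m ∸ i)) ∎

  scale-· : ∀ k f g n → ((λ i → k * f i) · g) n ≈ k * (f · g) n
  scale-· k f g n =
    trans (Σ<-cong (suc n) (λ i _ → *-assoc k (f i) _)) (sym (*-distribˡ-Σ< (suc n) k _))

  ·-one : ∀ f → (f · one) ≋ f
  ·-one f n = begin
    Σ< n (λ i → f i * one (n ∸ i)) + f n * one (n ∸ n)
      ≈⟨ +-cong (Σ<-zero n (λ i i<n → trans (*-congˡ (reflexive (one-∸ i<n))) (zeroʳ _)))
                (*-congˡ (coeff-n∸n one n)) ⟩
    0# + f n * 1#
      ≈⟨ trans (+-identityˡ _) (*-identityʳ _) ⟩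
    f n ∎

  ·-onePlus-suc : ∀ f k n → (f · onePlus k) (suc n) ≈ f (suc n) + f n * k
  ·-onePlus-suc f k n = begin
    (Σ< n (λ i → f i * onePlus k (suc n ∸ i)) + f n * onePlus k (suc n ∸ n))
      + f (suc n) * onePlus k (suc n ∸ suc n)
      ≈⟨ +-cong (+-cong (Σ<-zero n (λ i i<n → trans (*-congˡ (reflexive (onePlus-suc-∸ k i<n))) (zeroʳ _)))
                        (*-congˡ (reflexive (onePlus-suc-∸-self k n))))
                (*-congˡ (coeff-n∸n (onePlus k) n)) ⟩
    (0# + f n * k) + f (suc n) * 1#
      ≈⟨ trans (+-cong (+-identityˡ _) (*-identityʳ _)) (+-comm _ _) ⟩
    f (suc n) + f n * k ∎

  ^ˢ-coeff-zero : ∀ f k → (f ^ˢ k) 0 ≈ pow (f 0) k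
  ^ˢ-coeff-zero f zero    = refl
  ^ˢ-coeff-zero f (suc k) = trans (·-coeff-zero f (f ^ˢ k)) (*-congˡ (^ˢ-coeff-zero f k))

  ^ˢ-vanishes-below : ∀ {w} → w 0 ≈ 0# → ∀ {m k} → m < k → (w ^ˢ k) m ≈ 0#
  ^ˢ-vanishes-below {w} w₀≈0 {zero} {suc k} _ =
    trans (·-coeff-zero w (w ^ˢ k)) (trans (*-congʳ w₀≈0) (zeroˡ _))
  ^ˢ-vanishes-below {w} w₀≈0 {suc m} {suc k} (s≤s m<k) = begin
    (w · (w ^ˢ k)) (suc m)
      ≈⟨ ·-coeff-suc w (w ^ˢ k) m ⟩
    w 0 * (w ^ˢ k) (suc m) + Σ< (suc m) (λ i → w (suc i) * (w ^ˢ k) (m ∸ i))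
      ≈⟨ +-cong (trans (*-congʳ w₀≈0) (zeroˡ _))
                (Σ<-zero (suc m) (λ i _ →
                  trans (*-congˡ (^ˢ-vanishes-below w₀≈0 (≤-<-trans (m∸n≤m m i) m<k)))
                                                 (zeroʳ _))) ⟩
    0# + 0#
      ≈⟨ +-identityˡ _ ⟩
    0# ∎

  ^ˢ-diagonal : ∀ {w} → w 0 ≈ 0# → ∀ k → (w ^ˢ k) k ≈ pow (w 1) k
  ^ˢ-diagonal {w} w₀≈0 zero    = refl
  ^ˢ-diagonal {w} w₀≈0 (suc k) = begin
    (w · (w ^ˢ k)) (suc k)
      ≈⟨ ·-coeff-suc w (w ^ˢ k) k ⟩
    w 0 * (w ^ˢ k) (suc k) + Σ< (suc k) (λ i → w (suc i) * (w ^ˢ k) (k ∸ i))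
      ≈⟨ +-cong (trans (*-congʳ w₀≈0) (zeroˡ _)) (Σ<-first k _) ⟩
    0# + (w 1 * (w ^ˢ k) k + Σ< k (λ i → w (suc (suc i)) * (w ^ˢ k) (k ∸ suc i)))
      ≈⟨ +-identityˡ _ ⟩
    w 1 * (w ^ˢ k) k + Σ< k (λ i → w (suc (suc i)) * (w ^ˢ k) (k ∸ suc i))
      ≈⟨ +-cong (*-congˡ (^ˢ-diagonal w₀≈0 k)) (Σ<-zero k below-diagonal) ⟩
    w 1 * pow (w 1) k + 0#
      ≈⟨ +-identityʳ _ ⟩
    pow (w 1) (suc k) ∎
    where
    below-diagonal : ∀ i → i < k → w (suc (suc i)) * (w ^ˢ k) (k ∸ suc i) ≈ 0#
    below-diagonal i (s≤s i<k) =
      trans (*-congˡ (^ˢ-vanishes-below w₀≈0 (s≤s (m∸n≤m _ i)))) (zeroʳ _)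

  _≋[<_]_ : Series → ℕ → Series → Set ℓ
  f ≋[< m ] g = ∀ i → i < m → f i ≈ g i

  ≋⇒≋[<] : ∀ {f g} → f ≋ g → ∀ {m} → f ≋[< m ] g
  ≋⇒≋[<] f≋g i _ = f≋g i

  ≋[<]⇒≋ : ∀ {f g} → (∀ m → f ≋[< m ] g) → f ≋ g
  ≋[<]⇒≋ f≋[<]g n = f≋[<]g (suc n) n (n<1+n n)

  ≋[<]-extend : ∀ {f g m} → f ≋[< m ] g → f m ≈ g m → f ≋[< suc m ] g
  ≋[<]-extend {m = m} f≋g fm≈gm i (s≤s i≤m) with m≤n⇒m<n∨m≡n i≤m
  ... | inj₁ i<m    = f≋g i i<m
  ... | inj₂ P.refl = fm≈gm

  ≋-induction : ∀ {f g} → (∀ m → f ≋[< m ] g → f m ≈ g m) → f ≋ g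
  ≋-induction {f} {g} step = ≋[<]⇒≋ prefix
    where
    prefix : ∀ m → f ≋[< m ] g
    prefix zero    i ()
    prefix (suc m) = ≋[<]-extend (prefix m) (step m (prefix m))

  ·-cong< : ∀ m {f f' g g'} → f ≋[< m ] f' → g ≋[< m ] g' → (f · g) ≋[< m ] (f' · g')
  ·-cong< m f≋f' g≋g' n n<m = Σ<-cong (suc n) (λ i i<1+n →
    *-cong (f≋f' i (≤-<-trans (≤-pred i<1+n) n<m)) (g≋g' (n ∸ i) (≤-<-trans (m∸n≤m n i) n<m)))

  ^ˢ-cong< : ∀ m {f f'} → f ≋[< m ] f' → ∀ k → (f ^ˢ k) ≋[< m ] (f' ^ˢ k)
  ^ˢ-cong< m f≋f' zero    i _ = refl
  ^ˢ-cong< m f≋f' (suc k) = ·-cong< m f≋f' (^ˢ-cong< m f≋f' k)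

  shift-cong< : ∀ m {f f'} → f ≋[< m ] f' → shift f ≋[< suc m ] shift f'
  shift-cong< m f≋f' zero    _         = refl
  shift-cong< m f≋f' (suc i) (s≤s i<m) = f≋f' i i<m

  invert-cong< : ∀ m x {a a'} → a ≋[< m ] a' → invert x a ≋[< m ] invert x a'
  invert-cong< m x a≋a' n n<m = Σ<-cong (suc n) (λ k _ →
    *-congˡ (^ˢ-cong< m a≋a' (suc k) (n ∸ k) (≤-<-trans (m∸n≤m n k) n<m)))

  ∘ˢ-cong< : ∀ m {g g' f f'} → g ≋[< m ] g' → f ≋[< m ] f' → (g ∘ˢ f) ≋[< m ] (g' ∘ˢ f')
  ∘ˢ-cong< m g≋g' f≋f' n n<m = Σ<-cong (suc n) (λ k k<1+n →
    *-cong (g≋g' k (≤-<-trans (≤-pred k<1+n) n<m)) (^ˢ-cong< m f≋f' k n n<m))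

  ·-cong<-next : ∀ m {f f' g g'} → f 0 ≈ 0# → f' 0 ≈ 0# → g 0 ≈ 0# → g' 0 ≈ 0# →
                 f ≋[< m ] f' → g ≋[< m ] g' → (f · g) m ≈ (f' · g') m
  ·-cong<-next zero {f} {f'} {g} {g'} f₀≈0 f'₀≈0 _ _ _ _ = begin
    (f · g) 0     ≈⟨ trans (·-coeff-zero f g) (trans (*-congʳ f₀≈0) (zeroˡ _)) ⟩
    0#            ≈⟨ sym (trans (·-coeff-zero f' g') (trans (*-congʳ f'₀≈0) (zeroˡ _))) ⟩
    (f' · g') 0   ∎
  ·-cong<-next (suc m) {f} {f'} {g} {g'} f₀≈0 f'₀≈0 g₀≈0 g'₀≈0 f≋f' g≋g' = begin
    (f · g) (suc m)
      ≈⟨ ·-constantFree f g f₀≈0 g₀≈0 m ⟩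
    Σ< m (λ i → f (suc i) * g (m ∸ i))
      ≈⟨ Σ<-cong m (λ i i<m →
           *-cong (f≋f' (suc i) (s≤s i<m)) (g≋g' (m ∸ i) (s≤s (m∸n≤m m i)))) ⟩
    Σ< m (λ i → f' (suc i) * g' (m ∸ i))
      ≈⟨ sym (·-constantFree f' g' f'₀≈0 g'₀≈0 m) ⟩
    (f' · g') (suc m) ∎

  ·-cong : ∀ {f f' g g'} → f ≋ f' → g ≋ g' → (f · g) ≋ (f' · g')
  ·-cong f≋f' g≋g' = ≋[<]⇒≋ (λ m → ·-cong< m (≋⇒≋[<] f≋f') (≋⇒≋[<] g≋g'))

  invert-cong : ∀ x {a a'} → a ≋ a' → invert x a ≋ invert x a'
  invert-cong x a≋a' = ≋[<]⇒≋ (λ m → invert-cong< m x (≋⇒≋[<] a≋a'))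

  shift-cong : ∀ {f f'} → f ≋ f' → shift f ≋ shift f'
  shift-cong f≋f' zero    = refl
  shift-cong f≋f' (suc i) = f≋f' i

  ∘ˢ-cong : ∀ {g g' f f'} → g ≋ g' → f ≋ f' → (g ∘ˢ f) ≋ (g' ∘ˢ f')
  ∘ˢ-cong g≋g' f≋f' = ≋[<]⇒≋ (λ m → ∘ˢ-cong< m (≋⇒≋[<] g≋g') (≋⇒≋[<] f≋f'))

  IsRevert-cong : ∀ {a a' b b'} → a ≋ a' → b ≋ b' → IsRevert a b → IsRevert a' b'
  IsRevert-cong a≋a' b≋b' (ba≋X , ab≋X) =
      ≋-trans (∘ˢ-cong (shift-cong (≋-sym b≋b')) (shift-cong (≋-sym a≋a'))) ba≋X
    , ≋-trans (∘ˢ-cong (shift-cong (≋-sym a≋a')) (shift-cong (≋-sym b≋b'))) ab≋X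

  geometric : Carrier → Series
  geometric d n = pow d n

  geometric-cong : ∀ {d e} → d ≈ e → geometric d ≋ geometric e
  geometric-cong d≈e = pow-cong d≈e

  geometric-·-suc : ∀ d s n → (geometric d · s) (suc n) ≈ s (suc n) + d * (geometric d · s) n
  geometric-·-suc d s n =
    trans (·-coeff-suc (geometric d) s n) (+-cong (*-identityˡ _) (scale-· d (geometric d) s n))

  -- G = 1 + d t G for G = 1/(1 - d t), multiplied by s.
  geometric-· : ∀ d s n → (geometric d · s) n ≈ s n + d * (shift (geometric d) · s) n
  geometric-· d s zero = begin
    (geometric d · s) 0                 ≈⟨ trans (·-coeff-zero (geometric d) s) (*-identityˡ _) ⟩
    s 0                                 ≈⟨ sym (+-identityʳ _) ⟩
    s 0 + 0#                            ≈⟨ +-congˡ (sym (trans (*-congˡ shifted₀≈0) (zeroʳ d))) ⟩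
    s 0 + d * (shift (geometric d) · s) 0 ∎
    where
    shifted₀≈0 : (shift (geometric d) · s) 0 ≈ 0#
    shifted₀≈0 = trans (·-coeff-zero (shift (geometric d)) s) (zeroˡ _)
  geometric-· d s (suc n) =
    trans (geometric-·-suc d s n) (+-congˡ (*-congˡ (sym (shift-·-suc (geometric d) s n))))

  shift-geometric-^ˢ-suc : ∀ d k n →
    (shift (geometric d) ^ˢ suc k) (suc n)
      ≈ (shift (geometric d) ^ˢ k) n + d * (shift (geometric d) ^ˢ suc k) n
  shift-geometric-^ˢ-suc d k n =
    trans (shift-·-suc (geometric d) (shift (geometric d) ^ˢ k) n) (geometric-· d (shift (geometric d) ^ˢ k) n)

  invert-geometric-suc : ∀ x d n →
    invert x (geometric d) (suc n) ≈ (x + d) * invert x (geometric d) n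
  invert-geometric-suc x d n = begin
    Σ< (suc n) (λ k → pow x k * (G ^ˢ suc k) (suc n ∸ k)) + pow x (suc n) * (G ^ˢ suc (suc n)) (n ∸ n)
      ≈⟨ +-cong lower (*-congˡ (trans (G^-at-n∸n (suc (suc n))) (sym (G^-at-n∸n (suc n))))) ⟩
    (Σ< (suc n) (λ k → pow x k * (G ^ˢ k) (suc n ∸ k)) + d * T n) + pow x (suc n) * (G ^ˢ suc n) (n ∸ n)
      ≈⟨ +-assoc _ _ _ ⟩
    Σ< (suc n) (λ k → pow x k * (G ^ˢ k) (suc n ∸ k)) + (d * T n + pow x (suc n) * (G ^ˢ suc n) (n ∸ n))
      ≈⟨ trans (+-congˡ (+-comm _ _)) (sym (+-assoc _ _ _)) ⟩
    Σ< (suc (suc n)) (λ k → pow x k * (G ^ˢ k) (suc n ∸ k)) + d * T n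
      ≈⟨ +-congʳ unshifted ⟩
    x * T n + d * T n
      ≈⟨ sym (distribʳ _ _ _) ⟩
    (x + d) * T n ∎
    where
    G : Series
    G = geometric d
    T : ℕ → Carrier
    T = invert x G
    G^-at-n∸n : ∀ j → (G ^ˢ j) (n ∸ n) ≈ 1#
    G^-at-n∸n j = trans (coeff-n∸n (G ^ˢ j) n) (trans (^ˢ-coeff-zero G j) (pow-one j))
    step : ∀ k → k < suc n →
      pow x k * (G ^ˢ suc k) (suc n ∸ k)
        ≈ pow x k * (G ^ˢ k) (suc n ∸ k) + d * (pow x k * (G ^ˢ suc k) (n ∸ k))
    step k k<1+n rewrite +-∸-assoc 1 (≤-pred k<1+n) =
      trans (*-congˡ (geometric-·-suc d (G ^ˢ k) (n ∸ k)))
            (solve 4 (λ d p A B → p :* (A :+ d :* B) := p :* A :+ d :* (p :* B)) refl d (pow x k) _ _)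
    lower : Σ< (suc n) (λ k → pow x k * (G ^ˢ suc k) (suc n ∸ k))
              ≈ Σ< (suc n) (λ k → pow x k * (G ^ˢ k) (suc n ∸ k)) + d * T n
    lower = trans (Σ<-cong (suc n) step) (trans (Σ<-+ (suc n) _ _) (+-congˡ (sym (*-distribˡ-Σ< (suc n) d _))))
    unshifted : Σ< (suc (suc n)) (λ k → pow x k * (G ^ˢ k) (suc n ∸ k)) ≈ x * T n
    unshifted = begin
      Σ< (suc (suc n)) (λ k → pow x k * (G ^ˢ k) (suc n ∸ k))
        ≈⟨ Σ<-first (suc n) _ ⟩
      1# * 0# + Σ< (suc n) (λ k → (x * pow x k) * (G ^ˢ suc k) (n ∸ k))
        ≈⟨ +-cong (zeroʳ _) (Σ<-cong (suc n) (λ k _ → *-assoc x _ _)) ⟩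
      0# + Σ< (suc n) (λ k → x * (pow x k * (G ^ˢ suc k) (n ∸ k)))
        ≈⟨ trans (+-identityˡ _) (sym (*-distribˡ-Σ< (suc n) x _)) ⟩
      x * T n ∎

  invert-geometric : ∀ x d → invert x (geometric d) ≋ geometric (x + d)
  invert-geometric x d zero    = trans (+-identityˡ _) (trans (*-identityˡ _) (·-one (geometric d) 0))
  invert-geometric x d (suc n) = trans (invert-geometric-suc x d n) (*-congˡ (invert-geometric x d n))

  revert-geometric : ∀ d e → e + d ≈ 0# → (shift (geometric e) ∘ˢ shift (geometric d)) ≋ X
  revert-geometric d e e+d≈0 zero    = trans (+-identityˡ _) (zeroˡ _)
  revert-geometric d e e+d≈0 (suc n) = begin
    Σ< (suc (suc n)) (λ k → shift (geometric e) k * (w ^ˢ k) (suc n))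
      ≈⟨ Σ<-first (suc n) _ ⟩
    0# * (w ^ˢ 0) (suc n) + Σ< (suc n) (λ j → pow e j * (w ^ˢ suc j) (suc n))
      ≈⟨ trans (+-congʳ (zeroˡ _)) (+-identityˡ _) ⟩
    Σ< (suc n) (λ j → pow e j * (w ^ˢ suc j) (suc n))
      ≈⟨ Σ<-cong (suc n) (λ j _ → trans (*-congˡ (shift-geometric-^ˢ-suc d j n)) (distribˡ _ _ _)) ⟩
    Σ< (suc n) (λ j → pow e j * (w ^ˢ j) n + pow e j * (d * (w ^ˢ suc j) n))
      ≈⟨ Σ<-telescope n _ _ (λ j _ → cancel (pow e j) ((w ^ˢ suc j) n)) ⟩
    1# * one n + pow e n * (d * (w ^ˢ suc n) n)
      ≈⟨ +-cong (*-identityˡ _)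
           (trans (*-congˡ (trans (*-congˡ (^ˢ-vanishes-below refl (n<1+n n))) (zeroʳ d))) (zeroʳ _)) ⟩
    one n + 0#
      ≈⟨ +-identityʳ _ ⟩
    one n
      ≡⟨ P.sym (X-suc n) ⟩
    X (suc n) ∎
    where
    w : Series
    w = shift (geometric d)
    cancel : ∀ p W → p * (d * W) + (e * p) * W ≈ 0#
    cancel p W = begin
      p * (d * W) + (e * p) * W
        ≈⟨ solve 4 (λ d e p W → p :* (d :* W) :+ (e :* p) :* W := p :* ((e :+ d) :* W)) refl d e p W ⟩
      p * ((e + d) * W)         ≈⟨ *-congˡ (trans (*-congʳ e+d≈0) (zeroˡ W)) ⟩
      p * 0#                    ≈⟨ zeroʳ p ⟩
      0# ∎

  geometric-isRevert : ∀ {d e} → d + e ≈ 0# → IsRevert (geometric d) (geometric e)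
  geometric-isRevert {d} {e} d+e≈0 = revert-geometric d e (trans (+-comm e d) d+e≈0) , revert-geometric e d d+e≈0

  geometric-isFixedPoint : ∀ x e → x ≈ e + e → IsRevert (invert x (geometric (- e))) (geometric (- e))
  geometric-isFixedPoint x e x≈2e =
    IsRevert-cong (≋-sym (≋-trans (invert-geometric x (- e)) (geometric-cong x-e≈e))) (λ _ → refl)
                  (geometric-isRevert (-‿inverseʳ e))
    where
    x-e≈e : x + - e ≈ e
    x-e≈e = trans (+-congʳ x≈2e) (trans (+-assoc e e (- e)) (trans (+-congˡ (-‿inverseʳ e)) (+-identityʳ e)))

  geometric-·-onePlus : ∀ k → (geometric (- k) · onePlus k) ≋ one
  geometric-·-onePlus k zero    = trans (·-coeff-zero (geometric (- k)) (onePlus k)) (*-identityʳ 1#)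
  geometric-·-onePlus k (suc n) = begin
    (geometric (- k) · onePlus k) (suc n)
      ≈⟨ ·-onePlus-suc (geometric (- k)) k n ⟩
    - k * pow (- k) n + pow (- k) n * k
      ≈⟨ solve 3 (λ e p c → e :* p :+ p :* c := p :* (e :+ c)) refl (- k) (pow (- k) n) k ⟩
    pow (- k) n * (- k + k)
      ≈⟨ trans (*-congˡ (-‿inverseˡ k)) (zeroʳ _) ⟩
    0# ∎

  ·-onePlus≋one⇔ : ∀ k {a} → (a · onePlus k) ≋ one ⇔ a ≋ geometric (- k)
  ·-onePlus≋one⇔ k {a} = mk⇔ inverse⇒geometric
    (λ a≋G → ≋-trans (·-cong {g = onePlus k} a≋G (λ _ → refl)) (geometric-·-onePlus k))
    where
    inverse⇒geometric : (a · onePlus k) ≋ one → a ≋ geometric (- k)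
    inverse⇒geometric a·[1+kt]≋1 zero =
      trans (sym (*-identityʳ _)) (trans (sym (·-coeff-zero a (onePlus k))) (a·[1+kt]≋1 0))
    inverse⇒geometric a·[1+kt]≋1 (suc n) = begin
      a (suc n)  ≈⟨ +-inverseˡ-unique _ _ (trans (sym (·-onePlus-suc a k n)) (a·[1+kt]≋1 (suc n))) ⟩
      - (a n * k) ≈⟨ -‿distribʳ-* (a n) k ⟩
      a n * - k   ≈⟨ *-comm _ _ ⟩
      - k * a n   ≈⟨ *-congˡ (inverse⇒geometric a·[1+kt]≋1 n) ⟩
      pow (- k) (suc n) ∎

  invertRest : Carrier → Series → ℕ → Carrier
  invertRest x a n = Σ< n (λ k → pow x (suc k) * (a ^ˢ suc (suc k)) (n ∸ suc k))

  invert-split : ∀ x a n → invert x a n ≈ a n + invertRest x a n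
  invert-split x a n = trans (Σ<-first n _) (+-congʳ (trans (*-identityˡ _) (·-one a n)))

  revertRest : Carrier → Series → ℕ → Carrier
  revertRest x a n = invertRest x a (suc n)
    + Σ< n (λ j → a (suc j) * (shift (invert x a) ^ˢ suc (suc j)) (suc (suc n)))

  -- The terms k = 1 and k = n + 2 of the composition each contribute a_(n+1).
  revert-coeff : ∀ x a → a 0 ≈ 1# → ∀ n →
    (shift a ∘ˢ shift (invert x a)) (suc (suc n)) ≈ (a (suc n) + a (suc n)) + revertRest x a n
  revert-coeff x a a₀≈1 n = begin
    Σ< (suc m) F + F (suc m)
      ≈⟨ +-cong (trans (Σ<-first m F) (+-congˡ (Σ<-first n (λ j → F (suc j))))) last ⟩
    (F 0 + (F 1 + Σ< n (λ j → F (suc (suc j))))) + a m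
      ≈⟨ +-congʳ (trans (+-cong (zeroˡ 0#) (+-congʳ first)) (+-identityˡ _)) ⟩
    ((a m + invertRest x a m) + Σ< n (λ j → F (suc (suc j)))) + a m
      ≈⟨ solve 3 (λ p I Q → ((p :+ I) :+ Q) :+ p := (p :+ p) :+ (I :+ Q)) refl (a m) _ _ ⟩
    (a m + a m) + revertRest x a n ∎
    where
    m : ℕ
    m = suc n
    u : Series
    u = shift (invert x a)
    F : ℕ → Carrier
    F k = shift a k * (u ^ˢ k) (suc m)
    first : F 1 ≈ a m + invertRest x a m
    first = trans (*-cong a₀≈1 (·-one u (suc m))) (trans (*-identityˡ _) (invert-split x a m))
    u₁≈1 : u 1 ≈ 1#
    u₁≈1 = trans (invert-split x a 0) (trans (+-identityʳ _) a₀≈1)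
    last : F (suc m) ≈ a m
    last = trans (*-congˡ (trans (^ˢ-diagonal refl (suc m)) (trans (pow-cong u₁≈1 (suc m)) (pow-one (suc m)))))
                 (*-identityʳ _)

  revertRest-cong : ∀ x {a b} n → a ≋[< suc n ] b → revertRest x a n ≈ revertRest x b n
  revertRest-cong x {a} {b} n a≋b = +-cong
    (Σ<-cong (suc n) (λ k _ → *-congˡ (^ˢ-cong< (suc n) a≋b (suc (suc k)) (n ∸ k) (s≤s (m∸n≤m n k)))))
    (Σ<-cong n (λ j j<n → *-cong (a≋b (suc j) (s≤s j<n))
      (·-cong<-next (suc (suc n)) refl refl (u^-constantFree a j) (u^-constantFree b j)
                    u≋u' (^ˢ-cong< _ u≋u' (suc j)))))
    where
    u^-constantFree : ∀ s j → (shift (invert x s) ^ˢ suc j) 0 ≈ 0#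
    u^-constantFree s j = trans (^ˢ-coeff-zero _ (suc j)) (zeroˡ _)
    u≋u' : shift (invert x a) ≋[< suc (suc n) ] shift (invert x b)
    u≋u' = shift-cong< (suc n) (invert-cong< (suc n) x a≋b)

  fixedPoint-unique : ∀ {half} → (1# + 1#) * half ≈ 1# → ∀ x {a b} → a 0 ≈ 1# → b 0 ≈ 1# →
    (shift a ∘ˢ shift (invert x a)) ≋ X → (shift b ∘ˢ shift (invert x b)) ≋ X → a ≋ b
  fixedPoint-unique {half} 2·half≈1 x {a} {b} a₀≈1 b₀≈1 a-rev b-rev = ≋-induction step
    where
    halve : ∀ y → half * (y + y) ≈ y
    halve y = begin
      half * (y + y)         ≈⟨ solve 2 (λ h y → h :* (y :+ y) := ((con 1 :+ con 1) :* h) :* y) refl half y ⟩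
      ((1# + 1#) * half) * y ≈⟨ trans (*-congʳ 2·half≈1) (*-identityˡ y) ⟩
      y ∎
    step : ∀ m → a ≋[< m ] b → a m ≈ b m
    step zero    _   = trans a₀≈1 (sym b₀≈1)
    step (suc n) a≋b = begin
      a (suc n)                      ≈⟨ sym (halve _) ⟩
      half * (a (suc n) + a (suc n)) ≈⟨ *-congˡ (+-cancelʳ (revertRest x b n) _ _ doubled) ⟩
      half * (b (suc n) + b (suc n)) ≈⟨ halve _ ⟩
      b (suc n) ∎
      where
      doubled : (a (suc n) + a (suc n)) + revertRest x b n ≈ (b (suc n) + b (suc n)) + revertRest x b n
      doubled = begin
        (a (suc n) + a (suc n)) + revertRest x b n ≈⟨ +-congˡ (sym (revertRest-cong x n a≋b)) ⟩
        (a (suc n) + a (suc n)) + revertRest x a n ≈⟨ sym (revert-coeff x a a₀≈1 n) ⟩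
        (shift a ∘ˢ shift (invert x a)) (suc (suc n)) ≈⟨ a-rev (suc (suc n)) ⟩
        X (suc (suc n))                               ≈⟨ sym (b-rev (suc (suc n))) ⟩
        (shift b ∘ˢ shift (invert x b)) (suc (suc n)) ≈⟨ revert-coeff x b b₀≈1 n ⟩
        (b (suc n) + b (suc n)) + revertRest x b n ∎

theorem10 : ∀ {c ℓ} (R : CommutativeRing c ℓ) →
    let open CommutativeRing R
        open PowerSeries R
    in (half : Carrier) → (1# + 1#) * half ≈ 1# →
       (x : Carrier) → (a : Series) → a 0 ≈ 1# →
       (IsRevert (invert x a) a ⇔ ((a · onePlus (x * half)) ≋ one))
theorem10 R half 2·half≈1 x a a₀≈1 = mk⇔
    (λ a-fixed → Equivalence.from (·-onePlus≋one⇔ c)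
                   (fixedPoint-unique 2·half≈1 x a₀≈1 refl (proj₁ a-fixed) (proj₁ b-fixed)))
    (λ a·[1+ct]≋1 → let a≋b = Equivalence.to (·-onePlus≋one⇔ c) a·[1+ct]≋1 in
                    IsRevert-cong (invert-cong x (≋-sym a≋b)) (≋-sym a≋b) b-fixed)
  where
  open CommutativeRing R
  open PowerSeries R
  open SeriesLemmas R
  open import Relation.Binary.Reasoning.Setoid setoid
  open import Algebra.Solver.Ring.NaturalCoefficients.Default commutativeSemiring
  c : Carrier
  c = x * half
  x≈2c : x ≈ c + c
  x≈2c = begin
    x                      ≈⟨ sym (trans (*-congˡ 2·half≈1) (*-identityʳ x)) ⟩
    x * ((1# + 1#) * half) ≈⟨ solve 2 (λ x h → x :* ((con 1 :+ con 1) :* h) := x :* h :+ x :* h) refl x half ⟩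
    c + c ∎
  b-fixed : IsRevert (invert x (geometric (- c))) (geometric (- c))
  b-fixed = geometric-isFixedPoint x c x≈2c
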